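{- Let $G$ be a graph on $n\ge 5$ vertices such that $\chi_s(G)=\Delta(G)=n-2$. Then $G$ is not $(n-2)$-critical.
   Context: Standing assumption of the paper: all graphs are finite, undirected, simple and connected. $\Delta(G)$ is the maximum degree. A star coloring of $G$ is a proper vertex-coloring such that no path on four vertices (as a subgraph) is colored with only two colors; $\chi_s(G)$ is the minimum number of colors in a star coloring of $G$. $G$ is $k$-critical if $\chi_s(G)=k$ and $\chi_s(G-e)<\chi_s(G)$ for every edge $e$, where $G-e$ denotes deletion of the edge $e$. -}

module Defs where

open import Data.Nat using (ℕ; zero; suc; _<_; _≤_)
open import Data.Fin using (Fin)
open import Data.Fin.Properties using (_≟_)
open import Data.Bool using (Bool; true; false; _∧_; not)
open import Data.List using (List; length; filter)
open import Data.List using () renaming (allFin to allFinL)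
open import Data.Product using (Σ; ∃; _×_; _,_)
open import Relation.Binary.PropositionalEquality using (_≡_; _≢_)
open import Relation.Nullary using (¬_; does)

record Graph (n : ℕ) : Set where
  field
    adj   : Fin n → Fin n → Bool
    sym   : ∀ u v → adj u v ≡ adj v u
    irref : ∀ v → adj v v ≡ false
open Graph public

Adj : ∀ {n} → Graph n → Fin n → Fin n → Set
Adj G u v = adj G u v ≡ true

data Reach {n : ℕ} (G : Graph n) : Fin n → Fin n → Set where
  here : ∀ {v} → Reach G v v
  step : ∀ {u v w} → Adj G u v → Reach G v w → Reach G u w

Connected : ∀ {n} → Graph n → Set
Connected G = ∀ u v → Reach G u v

degree : ∀ {n} → Graph n → Fin n → ℕ
degree {n} G v = length (filter (λ u → adj G v u ≟B true) (allFinL n))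
  where
    open import Data.Bool.Properties renaming (_≟_ to _≟B_)

MaxDegree : ∀ {n} → Graph n → ℕ → Set
MaxDegree G d = (∀ v → degree G v ≤ d) × (∃ λ v → degree G v ≡ d)

IsStarColoring : ∀ {n} (G : Graph n) (k : ℕ) → (Fin n → Fin k) → Set
IsStarColoring {n} G k col =
  (∀ u v → Adj G u v → col u ≢ col v) ×
  (∀ (a b c d : Fin n) → a ≢ c → b ≢ d → a ≢ d →
     Adj G a b → Adj G b c → Adj G c d →
     ¬ (col a ≡ col c × col b ≡ col d))

StarColorable : ∀ {n} → Graph n → ℕ → Set
StarColorable {n} G k = Σ (Fin n → Fin k) (IsStarColoring G k)

StarChromatic : ∀ {n} → Graph n → ℕ → Set
StarChromatic G k = StarColorable G k × (∀ m → m < k → ¬ StarColorable G m)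

StarChromaticLt : ∀ {n} → Graph n → ℕ → Set
StarChromaticLt G k = ∃ λ m → m < k × StarColorable G m

deleteEdge : ∀ {n} → Graph n → Fin n → Fin n → Graph n
deleteEdge {n} G x y = record
  { adj = λ u v → adj G u v ∧ not (isxy u v)
  ; sym = λ u v → symProof u v
  ; irref = λ v → irr v }
  where
    open import Data.Bool.Properties using (∧-zeroˡ)
    open import Relation.Binary.PropositionalEquality using (cong₂; refl; cong)
    isxy : Fin n → Fin n → Bool
    isxy u v = (does (u ≟ x) ∧ does (v ≟ y)) Data.Bool.∨ (does (u ≟ y) ∧ does (v ≟ x))
    isxy-sym : ∀ u v → isxy u v ≡ isxy v u
    isxy-sym u v with u ≟ x | v ≟ y | u ≟ y | v ≟ x
    ... | p1 | p2 | p3 | p4 with does p1 | does p2 | does p3 | does p4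
    ... | true | true | true | true = refl
    ... | true | true | true | false = refl
    ... | true | true | false | true = refl
    ... | true | true | false | false = refl
    ... | true | false | true | true = refl
    ... | true | false | true | false = refl
    ... | true | false | false | true = refl
    ... | true | false | false | false = refl
    ... | false | true | true | true = refl
    ... | false | true | true | false = refl
    ... | false | true | false | true = refl
    ... | false | true | false | false = refl
    ... | false | false | true | true = refl
    ... | false | false | true | false = refl
    ... | false | false | false | true = refl
    ... | false | false | false | false = refl
    symProof : ∀ u v → (adj G u v ∧ not (isxy u v)) ≡ (adj G v u ∧ not (isxy v u))
    symProof u v = cong₂ _∧_ (sym G u v) (cong not (isxy-sym u v))
    irr : ∀ v → (adj G v v ∧ not (isxy v v)) ≡ false
    irr v rewrite irref G v = refl

Critical : ∀ {n} → Graph n → ℕ → Set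
Critical {n} G k =
  StarChromatic G k × (∀ (x y : Fin n) → Adj G x y → StarChromaticLt (deleteEdge G x y) k)

-- Let v be a vertex of degree n − 2 and w its unique non-neighbour. A star colouring with n − 3
-- colours arises whenever vertices can be merged into classes that save three colours (an
-- independent 4-set, an independent triple and a non-adjacent pair, or three non-adjacent pairs)
-- such that no path on four vertices alternates between two classes; as χ_s(G) = n − 2, no such
-- configuration exists. If G were critical, G − vx would have a star colouring f with at most
-- n − 3 colours, where x ∉ N[w] ∪ {v} has the fewest neighbours outside N[w] ∪ {v} (or x is
-- arbitrary if there is no such vertex). In G − vx the colour of v is shared only with w or x,
-- and a case analysis of the colour classes of f, fed by the pigeonhole principle, shows that f
-- is a star colouring of G or exhibits a mergeable configuration.

module Submission where

open import Defs renaming (sym to adj-sym)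
open import Data.Nat using (ℕ; zero; suc; _+_; _<_; _≤_; _∸_; z≤n; s≤s)
open import Data.Nat.Properties
  using (≤-refl; ≤-trans; ≤-reflexive; +-mono-≤; +-suc; m≤n⇒m≤1+n; n≮n; m≤n+m)
open import Data.Fin using (Fin; zero; suc; punchIn; punchOut)
open import Data.Fin.Properties
  using (_≟_; suc-injective; any?; pigeonhole; punchIn-injective; punchInᵢ≢i;
         punchIn-punchOut; punchOut-injective; <⇒≢)
open import Data.Bool using (Bool; true; false; _∨_)
open import Data.Bool.Properties using (∨-zeroʳ; ¬-not) renaming (_≟_ to _≟ᵇ_)
open import Data.List using (List; []; _∷_; length; filter; tabulate; allFin)
open import Data.List.Relation.Unary.All as All using (All; []; _∷_)
open import Data.List.Relation.Unary.Any using (here; there)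
open import Data.List.Relation.Unary.AllPairs using (AllPairs; []; _∷_)
open import Data.List.Relation.Unary.Unique.Propositional using (Unique)
open import Data.List.Membership.Propositional using (_∈_; _∉_)
open import Data.List.Membership.Propositional.Properties using (∈-filter⁺; ∈-allFin)
open import Data.List.Relation.Unary.All.Properties using (all-filter)
open import Data.List.Extrema.Nat using (argmin; argmin-all; f[argmin]≤f[xs])
open import Data.Product using (Σ-syntax; ∃-syntax; _×_; _,_; proj₁; proj₂)
open import Data.Sum using (_⊎_; inj₁; inj₂)
import Data.Sum
open import Data.Empty using (⊥; ⊥-elim)
open import Function using (_∘_)
open import Relation.Binary.PropositionalEquality
open import Relation.Binary.Construct.Union using (_∪_)
open import Relation.Nullary using (¬_; Dec; yes; no; does)
open import Relation.Nullary.Decidable using (_×-dec_; _⊎-dec_; ¬?; dec-true; dec-false; decidable-stable; map′)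

module AdjProperties {n : ℕ} (G : Graph n) where

  Adj? : ∀ a b → Dec (Adj G a b)
  Adj? a b = adj G a b ≟ᵇ true

  Adj-sym : ∀ {a b} → Adj G a b → Adj G b a
  Adj-sym {a} {b} = trans (adj-sym G b a)

  ¬Adj-sym : ∀ {a b} → ¬ Adj G a b → ¬ Adj G b a
  ¬Adj-sym ¬ab = ¬ab ∘ Adj-sym

  ¬Adj-refl : ∀ a → ¬ Adj G a a
  ¬Adj-refl a aa with () ← trans (sym (irref G a)) aa

  Adj⇒≢ : ∀ {a b} → Adj G a b → a ≢ b
  Adj⇒≢ {a} aa refl = ¬Adj-refl a aa

  ¬Adj⇒false : ∀ {a b} → ¬ Adj G a b → adj G a b ≡ false
  ¬Adj⇒false ¬ab = ¬-not ¬ab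

  Adj-¬Adj⇒≢ : ∀ {a b c} → Adj G a c → ¬ Adj G b c → a ≢ b
  Adj-¬Adj⇒≢ ac ¬bc refl = ¬bc ac

Adj-deleteEdge : ∀ {n} (G : Graph n) x y {a b} → Adj G a b →
  ¬ (a ≡ x × b ≡ y) → ¬ (a ≡ y × b ≡ x) → Adj (deleteEdge G x y) a b
Adj-deleteEdge G x y {a} {b} ab ¬xy ¬yx with a ≟ x | b ≟ y | a ≟ y | b ≟ x
... | yes p | yes q | _     | _     = ⊥-elim (¬xy (p , q))
... | _     | _     | yes p | yes q = ⊥-elim (¬yx (p , q))
... | yes _ | no _  | no _  | _     rewrite ab = refl
... | yes _ | no _  | yes _ | no _  rewrite ab = refl
... | no _  | _     | no _  | _     rewrite ab = refl
... | no _  | _     | yes _ | no _  rewrite ab = refl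

-- Counting and degrees

bool→ℕ : Bool → ℕ
bool→ℕ true  = 1
bool→ℕ false = 0

count : ∀ {m} → (Fin m → Bool) → ℕ
count {zero}  P = 0
count {suc m} P = bool→ℕ (P zero) + count (P ∘ suc)

length-filter-tabulate : ∀ {A : Set} {m} (g : Fin m → A) (P : A → Bool) →
  length (filter (λ a → P a ≟ᵇ true) (tabulate g)) ≡ count (P ∘ g)
length-filter-tabulate {m = zero}  g P = refl
length-filter-tabulate {m = suc m} g P with P (g zero)
... | true  = cong suc (length-filter-tabulate (g ∘ suc) P)
... | false = length-filter-tabulate (g ∘ suc) P

does⇒ : ∀ {A : Set} (a? : Dec A) → does a? ≡ true → A
does⇒ (yes a) _ = a

_⊆ᵇ_ : ∀ {m} → (Fin m → Bool) → (Fin m → Bool) → Set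
P ⊆ᵇ Q = ∀ i → P i ≡ true → Q i ≡ true

bool→ℕ-mono : ∀ a b → (a ≡ true → b ≡ true) → bool→ℕ a ≤ bool→ℕ b
bool→ℕ-mono true  b     a⇒b rewrite a⇒b refl = ≤-refl
bool→ℕ-mono false true  _   = z≤n
bool→ℕ-mono false false _   = ≤-refl

count-mono : ∀ {m} {P Q : Fin m → Bool} → P ⊆ᵇ Q → count P ≤ count Q
count-mono {zero}  P⊆Q = z≤n
count-mono {suc m} P⊆Q = +-mono-≤ (bool→ℕ-mono _ _ (P⊆Q zero)) (count-mono (P⊆Q ∘ suc))

count-< : ∀ {m} {P Q : Fin m → Bool} → P ⊆ᵇ Q → ∀ j → P j ≡ false → Q j ≡ true → count P < count Q
count-< {suc m} P⊆Q zero Pj Qj rewrite Pj | Qj = s≤s (count-mono (P⊆Q ∘ suc))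
count-< {suc m} {P} P⊆Q (suc j) Pj Qj =
  ≤-trans (≤-reflexive (sym (+-suc (bool→ℕ (P zero)) (count (P ∘ suc)))))
          (+-mono-≤ (bool→ℕ-mono _ _ (P⊆Q zero)) (count-< (P⊆Q ∘ suc) j Pj Qj))

count≤ : ∀ {m} (P : Fin m → Bool) → count P ≤ m
count≤ {zero}  P = z≤n
count≤ {suc m} P with P zero
... | true  = s≤s (count≤ (P ∘ suc))
... | false = m≤n⇒m≤1+n (count≤ (P ∘ suc))

count-all : ∀ {m} {P : Fin m → Bool} → (∀ i → P i ≡ true) → count P ≡ m
count-all {zero}  Pi = refl
count-all {suc m} Pi rewrite Pi zero = cong suc (count-all (Pi ∘ suc))

count-allBut : ∀ {m} (P : Fin m → Bool) j → (∀ i → i ≢ j → P i ≡ true) → m ≤ suc (count P)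
count-allBut {suc m} P zero Pi =
  s≤s (≤-trans (≤-reflexive (sym (count-all (λ i → Pi (suc i) (λ ()))))) (m≤n+m _ (bool→ℕ (P zero))))
count-allBut {suc m} P (suc j) Pi rewrite Pi zero (λ ()) =
  s≤s (count-allBut (P ∘ suc) j (λ i i≢j → Pi (suc i) (i≢j ∘ suc-injective)))

insert : ∀ {m} → Fin m → (Fin m → Bool) → Fin m → Bool
insert j P i = does (i ≟ j) ∨ P i

count-insert : ∀ {m} (P : Fin m → Bool) j → P j ≡ false → count P < count (insert j P)
count-insert P j Pj = count-< P⊆insert j Pj insert-self
  where
  P⊆insert : P ⊆ᵇ insert j P
  P⊆insert i Pi rewrite Pi = ∨-zeroʳ (does (i ≟ j))
  insert-self : insert j P j ≡ true
  insert-self rewrite dec-true (j ≟ j) refl = refl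

insert-other : ∀ {m} (P : Fin m → Bool) {i j} → i ≢ j → insert j P i ≡ P i
insert-other P {i} {j} i≢j rewrite dec-false (i ≟ j) i≢j = refl

module DegreeProperties {k : ℕ} (G : Graph (2 + k)) where
  open AdjProperties G

  degree≡count : ∀ v → degree G v ≡ count (adj G v)
  degree≡count v = length-filter-tabulate (λ i → i) (adj G v)

  nonNeighbour : ∀ v → degree G v ≡ k → ∃[ w ] w ≢ v × ¬ Adj G v w
  nonNeighbour v deg with any? (λ u → ¬? (u ≟ v) ×-dec ¬? (Adj? v u))
  ... | yes found = found
  ... | no none = ⊥-elim (n≮n (suc k) (begin
    2 + k                    ≤⟨ count-allBut (adj G v) v neighbour ⟩
    suc (count (adj G v))    ≡⟨ cong suc (trans (sym (degree≡count v)) deg) ⟩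
    suc k                    ∎))
    where
    open Data.Nat.Properties.≤-Reasoning
    neighbour : ∀ i → i ≢ v → Adj G v i
    neighbour i i≢v = decidable-stable (Adj? v i) (λ v≁i → none (i , i≢v , v≁i))

  adjacent-except : ∀ v w → degree G v ≡ k → w ≢ v → ¬ Adj G v w → ∀ u → u ≢ v → u ≢ w → Adj G v u
  adjacent-except v w deg w≢v v≁w u u≢v u≢w =
    decidable-stable (Adj? v u) (λ v≁u → n≮n (2 + k) (begin
      3 + k                        ≡⟨ cong (3 +_) (trans (sym deg) (degree≡count v)) ⟩
      3 + count (adj G v)          ≤⟨ s≤s (s≤s (count-insert (adj G v) v (¬Adj⇒false (¬Adj-refl v)))) ⟩
      2 + count Nᵥ                 ≤⟨ s≤s (count-insert Nᵥ w
                                        (trans (insert-other (adj G v) w≢v) (¬Adj⇒false v≁w))) ⟩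
      1 + count Nᵥʷ                ≤⟨ count-insert Nᵥʷ u (trans (insert-other Nᵥ u≢w)
                                        (trans (insert-other (adj G v) u≢v) (¬Adj⇒false v≁u))) ⟩
      count (insert u Nᵥʷ)         ≤⟨ count≤ (insert u Nᵥʷ) ⟩
      2 + k                        ∎))
    where
    open Data.Nat.Properties.≤-Reasoning
    Nᵥ Nᵥʷ : Fin (2 + k) → Bool
    Nᵥ  = insert v (adj G v)
    Nᵥʷ = insert w Nᵥ

-- Star colourings obtained by merging independent classes

allPairs-∈ : ∀ {A : Set} {R : A → A → Set} {xs x y} → (∀ {a b} → R a b → R b a) →
  AllPairs R xs → x ∈ xs → y ∈ xs → x ≡ y ⊎ R x y
allPairs-∈ R-sym (_   ∷ _)  (here refl) (here refl) = inj₁ refl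
allPairs-∈ R-sym (Rx ∷ _)  (here refl) (there y∈)  = inj₂ (All.lookup Rx y∈)
allPairs-∈ R-sym (Rx ∷ _)  (there x∈)  (here refl) = inj₂ (R-sym (All.lookup Rx x∈))
allPairs-∈ R-sym (_   ∷ Rs) (there x∈)  (there y∈)  = allPairs-∈ R-sym Rs x∈ y∈

module Merging {n : ℕ} (G : Graph n) where
  open AdjProperties G
  open import Data.List.Membership.DecPropositional (_≟_ {n}) using (_∈?_)

  private
    V : Set
    V = Fin n

  Independent : List V → Set
  Independent = AllPairs (λ a b → ¬ Adj G a b)

  independent-∈ : ∀ {A a b} → Independent A → a ∈ A → b ∈ A → ¬ Adj G a b
  independent-∈ indA a∈ b∈ with allPairs-∈ ¬Adj-sym indA a∈ b∈
  ... | inj₁ refl = ¬Adj-refl _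
  ... | inj₂ ¬ab  = ¬ab

  Nonadjacent : (V → V → Set) → Set
  Nonadjacent R = ∀ {a b} → R a b → ¬ Adj G a b

  Together : List V → V → V → Set
  Together A u u′ = u ∈ A × u′ ∈ A

  -- Giving R-related vertices and S-related vertices equal colours creates no bicoloured P₄.
  NoBicolouredP₄ : (V → V → Set) → (V → V → Set) → Set
  NoBicolouredP₄ R S = ∀ {a b c d} → R a c → a ≢ c → S b d → b ≢ d →
    Adj G a b → Adj G b c → Adj G c d → ⊥

  nonadjacent-together : ∀ {A} → Independent A → Nonadjacent (Together A)
  nonadjacent-together indA (a∈ , b∈) = independent-∈ indA a∈ b∈

  nonadjacent-∪ : ∀ {R S} → Nonadjacent R → Nonadjacent S → Nonadjacent (R ∪ S)
  nonadjacent-∪ ¬R ¬S = Data.Sum.[ ¬R , ¬S ]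

  noBicolouredP₄-sym : ∀ {A B} → NoBicolouredP₄ (Together A) (Together B) →
    NoBicolouredP₄ (Together B) (Together A)
  noBicolouredP₄-sym nb (a∈ , c∈) a≢c (b∈ , d∈) b≢d ab bc cd =
    nb (d∈ , b∈) (b≢d ∘ sym) (c∈ , a∈) (a≢c ∘ sym) (Adj-sym cd) (Adj-sym bc) (Adj-sym ab)

  noBicolouredP₄-independent : ∀ {A} → Independent A → NoBicolouredP₄ (Together A) (Together A)
  noBicolouredP₄-independent indA (a∈ , _) _ (b∈ , _) _ ab _ _ = independent-∈ indA a∈ b∈ ab

  noBicolouredP₄-pair : ∀ {A t₁ t₂} → All (λ s → ¬ Adj G s t₁ ⊎ ¬ Adj G s t₂) A →
    NoBicolouredP₄ (Together A) (Together (t₁ ∷ t₂ ∷ []))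
  noBicolouredP₄-pair {A} {t₁} {t₂} misses (_ , c∈) _ (b∈ , d∈) b≢d _ bc cd =
    adjacentToBoth (All.lookup misses c∈) b∈ d∈ b≢d (Adj-sym bc) cd
    where
    adjacentToBoth : ∀ {c b d} → ¬ Adj G c t₁ ⊎ ¬ Adj G c t₂ → b ∈ t₁ ∷ t₂ ∷ [] → d ∈ t₁ ∷ t₂ ∷ [] →
      b ≢ d → Adj G c b → Adj G c d → ⊥
    adjacentToBoth _ (here refl) (here refl) b≢d _ _ = b≢d refl
    adjacentToBoth _ (there (here refl)) (there (here refl)) b≢d _ _ = b≢d refl
    adjacentToBoth (inj₁ ¬c₁) (here refl) (there (here refl)) _ c₁ _ = ¬c₁ c₁
    adjacentToBoth (inj₂ ¬c₂) (here refl) (there (here refl)) _ _ c₂ = ¬c₂ c₂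
    adjacentToBoth (inj₁ ¬c₁) (there (here refl)) (here refl) _ _ c₁ = ¬c₁ c₁
    adjacentToBoth (inj₂ ¬c₂) (there (here refl)) (here refl) _ c₂ _ = ¬c₂ c₂

  noBicolouredP₄-∪ˡ : ∀ {R S T} → NoBicolouredP₄ R T → NoBicolouredP₄ S T → NoBicolouredP₄ (R ∪ S) T
  noBicolouredP₄-∪ˡ nbR nbS (inj₁ Rac) = nbR Rac
  noBicolouredP₄-∪ˡ nbR nbS (inj₂ Sac) = nbS Sac

  noBicolouredP₄-∪ʳ : ∀ {R S T} → NoBicolouredP₄ R S → NoBicolouredP₄ R T → NoBicolouredP₄ R (S ∪ T)
  noBicolouredP₄-∪ʳ nbS nbT Rac a≢c (inj₁ Sbd) = nbS Rac a≢c Sbd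
  noBicolouredP₄-∪ʳ nbS nbT Rac a≢c (inj₂ Tbd) = nbT Rac a≢c Tbd

  noBicolouredP₄-cons : ∀ {t A B} → All (λ b → ¬ Adj G t b) B →
    NoBicolouredP₄ (Together A) (Together B) → NoBicolouredP₄ (Together (t ∷ A)) (Together B)
  noBicolouredP₄-cons t≁B nb (here refl , _) _ (b∈ , _) _ ab _ _ = All.lookup t≁B b∈ ab
  noBicolouredP₄-cons t≁B nb (there _ , here refl) _ (b∈ , _) _ _ bc _ = All.lookup t≁B b∈ (Adj-sym bc)
  noBicolouredP₄-cons t≁B nb (there a∈ , there c∈) a≢c = nb (a∈ , c∈) a≢c

  ClassMap : (V → V → Set) → (V → V) → Set
  ClassMap Same f = ∀ {u u′} → f u ≡ f u′ → u ≡ u′ ⊎ Same u u′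

  -- Colours are vertices here: rep sends every vertex of a class to the representative of the class.
  isStarColoring-classMap : ∀ {Same rep} → ClassMap Same rep →
    Nonadjacent Same → NoBicolouredP₄ Same Same → IsStarColoring G n rep
  isStarColoring-classMap {Same} {rep} classes nonadjacent noBicoloured = proper , starry
    where
    proper : ∀ a b → Adj G a b → rep a ≢ rep b
    proper a b ab e with classes e
    ... | inj₁ refl = ¬Adj-refl a ab
    ... | inj₂ Sab  = nonadjacent Sab ab
    starry : ∀ a b c d → a ≢ c → b ≢ d → a ≢ d → Adj G a b → Adj G b c → Adj G c d →
      ¬ (rep a ≡ rep c × rep b ≡ rep d)
    starry a b c d a≢c b≢d _ ab bc cd (ac , bd) with classes ac | classes bd
    ... | inj₁ a≡c | _         = a≢c a≡c
    ... | inj₂ _   | inj₁ b≡d  = b≢d b≡d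
    ... | inj₂ Sac | inj₂ Sbd  = noBicoloured Sac a≢c Sbd b≢d ab bc cd

  redirect : List V → V → (V → V) → V → V
  redirect C r f u with u ∈? C
  ... | yes _ = r
  ... | no _  = f u

  ∉⇒≢ : ∀ {C : List V} {j u} → j ∈ C → u ∉ C → u ≢ j
  ∉⇒≢ j∈ u∉ refl = u∉ j∈

  redirect-≢ : ∀ C {r f j} u → r ≢ j → (u ∉ C → f u ≢ j) → redirect C r f u ≢ j
  redirect-≢ C u r≢j fu≢j with u ∈? C
  ... | yes _  = r≢j
  ... | no u∉ = fu≢j u∉

  redirect-classMap : ∀ {C r f Same} → ClassMap Same f → (∀ {u} → u ∉ C → f u ≢ r) →
    ClassMap (Together C ∪ Same) (redirect C r f)
  redirect-classMap {C} classes r-fresh {u} {u′} e with u ∈? C | u′ ∈? C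
  ... | yes u∈ | yes u′∈ = inj₂ (inj₁ (u∈ , u′∈))
  ... | yes _  | no u′∉  = ⊥-elim (r-fresh u′∉ (sym e))
  ... | no u∉  | yes _   = ⊥-elim (r-fresh u∉ e)
  ... | no _   | no _    = Data.Sum.map₂ inj₂ (classes e)

  redirect-id-classMap : ∀ {C r} → r ∈ C → ClassMap (Together C) (redirect C r (λ u → u))
  redirect-id-classMap {C} r∈ {u} {u′} e with u ∈? C | u′ ∈? C
  ... | yes u∈ | yes u′∈ = inj₂ (u∈ , u′∈)
  ... | yes _  | no u′∉  = ⊥-elim (∉⇒≢ r∈ u′∉ (sym e))
  ... | no u∉  | yes _   = ⊥-elim (∉⇒≢ r∈ u∉ e)
  ... | no _   | no _    = inj₁ e

isStarColoring-∘ : ∀ {n k l} (G : Graph n) {c : Fin n → Fin k} → IsStarColoring G k c →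
  (g : Fin k → Fin l) → (∀ {a b} → g (c a) ≡ g (c b) → c a ≡ c b) → IsStarColoring G l (g ∘ c)
isStarColoring-∘ G (proper , starry) g reflect =
  (λ a b ab → proper a b ab ∘ reflect) ,
  (λ a b c d a≢c b≢d a≢d ab bc cd (ac , bd) → starry a b c d a≢c b≢d a≢d ab bc cd (reflect ac , reflect bd))

-- punchOut with the junk value zero at j itself.
punchOut₀ : ∀ {m} → Fin (suc (suc m)) → Fin (suc (suc m)) → Fin (suc m)
punchOut₀ j u with j ≟ u
... | yes _   = zero
... | no j≢u = punchOut j≢u

punchOut₀-injective : ∀ {m} {j u u′ : Fin (suc (suc m))} → u ≢ j → u′ ≢ j → punchOut₀ j u ≡ punchOut₀ j u′ → u ≡ u′
punchOut₀-injective {j = j} {u} {u′} u≢j u′≢j e with j ≟ u | j ≟ u′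
... | yes j≡u | _        = ⊥-elim (u≢j (sym j≡u))
... | no _    | yes j≡u′ = ⊥-elim (u′≢j (sym j≡u′))
... | no j≢u  | no j≢u′  = punchOut-injective j≢u j≢u′ e

injectionAvoiding₃ : ∀ {m} {j₁ j₂ j₃ : Fin (3 + suc m)} → Unique (j₁ ∷ j₂ ∷ j₃ ∷ []) →
  Σ[ h ∈ (Fin (3 + suc m) → Fin (suc m)) ]
    (∀ {u u′} → u ∉ j₁ ∷ j₂ ∷ j₃ ∷ [] → u′ ∉ j₁ ∷ j₂ ∷ j₃ ∷ [] → h u ≡ h u′ → u ≡ u′)
injectionAvoiding₃ {j₁ = j₁} {j₂} {j₃} ((j₁≢j₂ ∷ j₁≢j₃ ∷ []) ∷ (j₂≢j₃ ∷ []) ∷ [] ∷ []) = h₃ , h₃-injective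
  where
  h₁ = punchOut₀ j₁
  h₂ = punchOut₀ (h₁ j₂) ∘ h₁
  h₃ = punchOut₀ (h₂ j₃) ∘ h₂
  h₁-injective : ∀ {u u′} → u ≢ j₁ → u′ ≢ j₁ → h₁ u ≡ h₁ u′ → u ≡ u′
  h₁-injective = punchOut₀-injective
  h₂-injective : ∀ {u u′} → u ≢ j₁ → u ≢ j₂ → u′ ≢ j₁ → u′ ≢ j₂ → h₂ u ≡ h₂ u′ → u ≡ u′
  h₂-injective u≢j₁ u≢j₂ u′≢j₁ u′≢j₂ =
    h₁-injective u≢j₁ u′≢j₁ ∘
    punchOut₀-injective (u≢j₂ ∘ h₁-injective u≢j₁ (j₁≢j₂ ∘ sym)) (u′≢j₂ ∘ h₁-injective u′≢j₁ (j₁≢j₂ ∘ sym))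
  h₃-injective : ∀ {u u′} → u ∉ j₁ ∷ j₂ ∷ j₃ ∷ [] → u′ ∉ j₁ ∷ j₂ ∷ j₃ ∷ [] → h₃ u ≡ h₃ u′ → u ≡ u′
  h₃-injective {u} {u′} u∉ u′∉ =
    h₂-injective (u∉ ∘ here) (u∉ ∘ there ∘ here) (u′∉ ∘ here) (u′∉ ∘ there ∘ here) ∘
    punchOut₀-injective (away u∉) (away u′∉)
    where
    away : ∀ {x} → x ∉ j₁ ∷ j₂ ∷ j₃ ∷ [] → h₂ x ≢ h₂ j₃
    away x∉ = x∉ ∘ there ∘ there ∘ here ∘
      h₂-injective (x∉ ∘ here) (x∉ ∘ there ∘ here) (j₁≢j₃ ∘ sym) (j₂≢j₃ ∘ sym)

starColorable-avoiding₃ : ∀ {m} (G : Graph (3 + suc m)) {c} → IsStarColoring G (3 + suc m) c →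
  ∀ {j₁ j₂ j₃} → Unique (j₁ ∷ j₂ ∷ j₃ ∷ []) → All (λ j → ∀ u → c u ≢ j) (j₁ ∷ j₂ ∷ j₃ ∷ []) →
  StarColorable G (suc m)
starColorable-avoiding₃ G {c} star js-unique avoided with injectionAvoiding₃ js-unique
... | h , h-injective =
  h ∘ c , isStarColoring-∘ G star h (λ {a} {b} → h-injective (notHit a avoided) (notHit b avoided))
  where
  notHit : ∀ {js} u → All (λ j → ∀ u → c u ≢ j) js → c u ∉ js
  notHit u (c≢j ∷ _)    (here cu≡j) = c≢j u cu≡j
  notHit u (_ ∷ avoids) (there cu∈) = notHit u avoids cu∈

module Configurations {m : ℕ} (G : Graph (3 + suc m)) where
  open Merging G

  pairIndependent : ∀ {a b} → ¬ Adj G a b → Independent (a ∷ b ∷ [])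
  pairIndependent ¬ab = (¬ab ∷ []) ∷ [] ∷ []

  mergeQuadruple : ∀ {a b c d} → Unique (a ∷ b ∷ c ∷ d ∷ []) → Independent (a ∷ b ∷ c ∷ d ∷ []) →
    StarColorable G (suc m)
  mergeQuadruple {a} {b} {c} {d} ((a≢b ∷ a≢c ∷ a≢d ∷ []) ∷ bcd-unique) indQ =
    starColorable-avoiding₃ G star bcd-unique
      (avoids a≢b (there (here refl)) ∷ avoids a≢c (there (there (here refl))) ∷
       avoids a≢d (there (there (there (here refl)))) ∷ [])
    where
    Q = a ∷ b ∷ c ∷ d ∷ []
    rep = redirect Q a (λ u → u)
    star : IsStarColoring G (3 + suc m) rep
    star = isStarColoring-classMap (redirect-id-classMap (here refl))
             (nonadjacent-together indQ) (noBicolouredP₄-independent indQ)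
    avoids : ∀ {j} → a ≢ j → j ∈ Q → ∀ u → rep u ≢ j
    avoids a≢j j∈ u = redirect-≢ Q u a≢j (∉⇒≢ j∈)

  mergeTripleAndPair : ∀ {s₁ s₂ s₃ t₁ t₂} → Unique (s₁ ∷ s₂ ∷ s₃ ∷ t₁ ∷ t₂ ∷ []) →
    Independent (s₁ ∷ s₂ ∷ s₃ ∷ []) → ¬ Adj G t₁ t₂ →
    NoBicolouredP₄ (Together (s₁ ∷ s₂ ∷ s₃ ∷ [])) (Together (t₁ ∷ t₂ ∷ [])) → StarColorable G (suc m)
  mergeTripleAndPair {s₁} {s₂} {s₃} {t₁} {t₂}
    ((s₁≢s₂ ∷ s₁≢s₃ ∷ s₁≢t₁ ∷ s₁≢t₂ ∷ []) ∷ (s₂≢s₃ ∷ s₂≢t₁ ∷ s₂≢t₂ ∷ []) ∷ (s₃≢t₁ ∷ s₃≢t₂ ∷ []) ∷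
     (t₁≢t₂ ∷ []) ∷ [] ∷ [])
    indS ¬t₁t₂ nbST =
    starColorable-avoiding₃ G star ((s₂≢s₃ ∷ s₂≢t₂ ∷ []) ∷ (s₃≢t₂ ∷ []) ∷ [] ∷ [])
      (avoidsS s₁≢s₂ (s₂≢t₁ ∘ sym) (there (here refl)) ∷
       avoidsS s₁≢s₃ (s₃≢t₁ ∘ sym) (there (there (here refl))) ∷
       avoidsT s₁≢t₂ t₁≢t₂ (there (here refl)) ∷ [])
    where
    S = s₁ ∷ s₂ ∷ s₃ ∷ []
    T = t₁ ∷ t₂ ∷ []
    indT = pairIndependent ¬t₁t₂
    rep = redirect S s₁ (redirect T t₁ (λ u → u))
    classes : ClassMap (Together S ∪ Together T) rep
    classes = redirect-classMap (redirect-id-classMap (here refl))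
                (λ {u} u∉S → redirect-≢ T u (s₁≢t₁ ∘ sym) (λ _ → ∉⇒≢ (here refl) u∉S))
    star : IsStarColoring G (3 + suc m) rep
    star = isStarColoring-classMap classes
             (nonadjacent-∪ (nonadjacent-together indS) (nonadjacent-together indT))
             (noBicolouredP₄-∪ˡ
               (noBicolouredP₄-∪ʳ (noBicolouredP₄-independent indS) nbST)
               (noBicolouredP₄-∪ʳ (noBicolouredP₄-sym nbST) (noBicolouredP₄-independent indT)))
    avoidsS : ∀ {j} → s₁ ≢ j → t₁ ≢ j → j ∈ S → ∀ u → rep u ≢ j
    avoidsS s₁≢j t₁≢j j∈ u = redirect-≢ S u s₁≢j (λ u∉S → redirect-≢ T u t₁≢j (λ _ → ∉⇒≢ j∈ u∉S))
    avoidsT : ∀ {j} → s₁ ≢ j → t₁ ≢ j → j ∈ T → ∀ u → rep u ≢ j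
    avoidsT s₁≢j t₁≢j j∈ u = redirect-≢ S u s₁≢j (λ _ → redirect-≢ T u t₁≢j (∉⇒≢ j∈))

  mergeThreePairs : ∀ {a₁ b₁ a₂ b₂ a₃ b₃} → Unique (a₁ ∷ b₁ ∷ a₂ ∷ b₂ ∷ a₃ ∷ b₃ ∷ []) →
    ¬ Adj G a₁ b₁ → ¬ Adj G a₂ b₂ → ¬ Adj G a₃ b₃ →
    NoBicolouredP₄ (Together (a₁ ∷ b₁ ∷ [])) (Together (a₂ ∷ b₂ ∷ [])) →
    NoBicolouredP₄ (Together (a₁ ∷ b₁ ∷ [])) (Together (a₃ ∷ b₃ ∷ [])) →
    NoBicolouredP₄ (Together (a₂ ∷ b₂ ∷ [])) (Together (a₃ ∷ b₃ ∷ [])) → StarColorable G (suc m)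
  mergeThreePairs {a₁} {b₁} {a₂} {b₂} {a₃} {b₃}
    ((a₁≢b₁ ∷ a₁≢a₂ ∷ a₁≢b₂ ∷ a₁≢a₃ ∷ a₁≢b₃ ∷ []) ∷ (b₁≢a₂ ∷ b₁≢b₂ ∷ b₁≢a₃ ∷ b₁≢b₃ ∷ []) ∷
     (a₂≢b₂ ∷ a₂≢a₃ ∷ a₂≢b₃ ∷ []) ∷ (b₂≢a₃ ∷ b₂≢b₃ ∷ []) ∷ (a₃≢b₃ ∷ []) ∷ [] ∷ [])
    ¬a₁b₁ ¬a₂b₂ ¬a₃b₃ nb₁₂ nb₁₃ nb₂₃ =
    starColorable-avoiding₃ G star ((b₁≢b₂ ∷ b₁≢b₃ ∷ []) ∷ (b₂≢b₃ ∷ []) ∷ [] ∷ [])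
      (avoids₁ ∷ avoids₂ ∷ avoids₃ ∷ [])
    where
    P₁ = a₁ ∷ b₁ ∷ []
    P₂ = a₂ ∷ b₂ ∷ []
    P₃ = a₃ ∷ b₃ ∷ []
    ind₁ = pairIndependent ¬a₁b₁
    ind₂ = pairIndependent ¬a₂b₂
    ind₃ = pairIndependent ¬a₃b₃
    b∈ : ∀ {a b} → b ∈ a ∷ b ∷ []
    b∈ = there (here refl)
    rep = redirect P₁ a₁ (redirect P₂ a₂ (redirect P₃ a₃ (λ u → u)))
    classes : ClassMap (Together P₁ ∪ (Together P₂ ∪ Together P₃)) rep
    classes =
      redirect-classMap
        (redirect-classMap (redirect-id-classMap (here refl))
          (λ {u} u∉P₂ → redirect-≢ P₃ u (a₂≢a₃ ∘ sym) (λ _ → ∉⇒≢ (here refl) u∉P₂)))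
        (λ {u} u∉P₁ → redirect-≢ P₂ u (a₁≢a₂ ∘ sym)
          (λ _ → redirect-≢ P₃ u (a₁≢a₃ ∘ sym) (λ _ → ∉⇒≢ (here refl) u∉P₁)))
    star : IsStarColoring G (3 + suc m) rep
    star = isStarColoring-classMap classes
      (nonadjacent-∪ (nonadjacent-together ind₁)
        (nonadjacent-∪ (nonadjacent-together ind₂) (nonadjacent-together ind₃)))
      (noBicolouredP₄-∪ˡ
        (noBicolouredP₄-∪ʳ (noBicolouredP₄-independent ind₁) (noBicolouredP₄-∪ʳ nb₁₂ nb₁₃))
        (noBicolouredP₄-∪ˡ
          (noBicolouredP₄-∪ʳ (noBicolouredP₄-sym nb₁₂)
            (noBicolouredP₄-∪ʳ (noBicolouredP₄-independent ind₂) nb₂₃))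
          (noBicolouredP₄-∪ʳ (noBicolouredP₄-sym nb₁₃)
            (noBicolouredP₄-∪ʳ (noBicolouredP₄-sym nb₂₃) (noBicolouredP₄-independent ind₃)))))
    avoids₁ : ∀ u → rep u ≢ b₁
    avoids₁ u = redirect-≢ P₁ u a₁≢b₁ (λ u∉P₁ → redirect-≢ P₂ u (b₁≢a₂ ∘ sym)
                  (λ _ → redirect-≢ P₃ u (b₁≢a₃ ∘ sym) (λ _ → ∉⇒≢ b∈ u∉P₁)))
    avoids₂ : ∀ u → rep u ≢ b₂
    avoids₂ u = redirect-≢ P₁ u a₁≢b₂ (λ _ → redirect-≢ P₂ u a₂≢b₂
                  (λ u∉P₂ → redirect-≢ P₃ u (b₂≢a₃ ∘ sym) (λ _ → ∉⇒≢ b∈ u∉P₂)))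
    avoids₃ : ∀ u → rep u ≢ b₃
    avoids₃ u = redirect-≢ P₁ u a₁≢b₃ (λ _ → redirect-≢ P₂ u a₂≢b₃
                  (λ _ → redirect-≢ P₃ u a₃≢b₃ (∉⇒≢ b∈)))

-- Pigeonhole

module _ {k : ℕ} {p q : Fin (3 + k)} (p≢q : p ≢ q) where

  skip₂ : Fin (suc k) → Fin (3 + k)
  skip₂ = punchIn p ∘ punchIn (punchOut p≢q)

  skip₂-injective : ∀ i j → skip₂ i ≡ skip₂ j → i ≡ j
  skip₂-injective i j = punchIn-injective (punchOut p≢q) i j ∘ punchIn-injective p _ _

  skip₂≢p : ∀ i → skip₂ i ≢ p
  skip₂≢p i = punchInᵢ≢i p _

  skip₂≢q : ∀ i → skip₂ i ≢ q
  skip₂≢q i e = punchInᵢ≢i (punchOut p≢q) i (punchIn-injective p _ _ (trans e (sym (punchIn-punchOut p≢q))))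

record Collision {n c : ℕ} (f : Fin n → Fin c) (p q : Fin n) : Set where
  constructor collision
  field
    {a b} : Fin n
    a≢b   : a ≢ b
    a≢p   : a ≢ p
    a≢q   : a ≢ q
    b≢p   : b ≢ p
    b≢q   : b ≢ q
    fa≡fb : f a ≡ f b

collisionAvoiding : ∀ {k c} → c < suc k → (f : Fin (3 + k) → Fin c) → ∀ {p q} → p ≢ q → Collision f p q
collisionAvoiding c<k f p≢q =
  let i , j , i<j , fi≡fj = pigeonhole c<k (f ∘ skip₂ p≢q) in
  collision (<⇒≢ i<j ∘ skip₂-injective p≢q i j)
    (skip₂≢p p≢q i) (skip₂≢q p≢q i) (skip₂≢p p≢q j) (skip₂≢q p≢q j) fi≡fj

-- A vertex of degree n − 2

module Setting {m : ℕ} (G : Graph (4 + m)) {v w : Fin (4 + m)}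
  (v≢w : v ≢ w) (v≁w : ¬ Adj G v w) (v-dominates : ∀ u → u ≢ v → u ≢ w → Adj G v u)
  (¬colourable : ¬ StarColorable G (suc m)) where
  open AdjProperties G
  open Merging G
  open Configurations G

  private
    V : Set
    V = Fin (4 + m)

  noIndependentQuadruple : ∀ {a b c d} → Unique (a ∷ b ∷ c ∷ d ∷ []) → ¬ Independent (a ∷ b ∷ c ∷ d ∷ [])
  noIndependentQuadruple distinct = ¬colourable ∘ mergeQuadruple distinct

  neighbourOfW≢v : ∀ {y} → Adj G w y → y ≢ v
  neighbourOfW≢v wy = Adj-¬Adj⇒≢ (Adj-sym wy) v≁w

  record Distant (u : V) : Set where
    constructor distant
    field
      ≢v : u ≢ v
      ≢w : u ≢ w
      w≁ : ¬ Adj G w u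

    ≁w : ¬ Adj G u w
    ≁w = ¬Adj-sym w≁

  open Distant

  WDominates : Set
  WDominates = ∀ u → u ≢ v → u ≢ w → Adj G w u

  -- What choosing x with the fewest distant neighbours guarantees.
  MinimalNeighbourhood : V → Set
  MinimalNeighbourhood x = ∀ {p q} → Distant p → Distant q → Adj G x p → ¬ Adj G q p → ¬ Adj G x q →
    ∃[ z ] Distant z × Adj G z q × ¬ Adj G z x

  Choice : V → Set
  Choice x = (Distant x × MinimalNeighbourhood x) ⊎ WDominates

  Distant? : ∀ u → Dec (Distant u)
  Distant? u = map′ (λ (u≢v , u≢w , w≁u) → distant u≢v u≢w w≁u) (λ uD → ≢v uD , ≢w uD , w≁ uD)
    (¬? (u ≟ v) ×-dec ¬? (u ≟ w) ×-dec ¬? (Adj? w u))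

  DistantNeighbour? : ∀ u z → Dec (Distant z × Adj G u z)
  DistantNeighbour? u z = Distant? z ×-dec Adj? u z

  distantDegree : V → ℕ
  distantDegree u = count (does ∘ DistantNeighbour? u)

  minimalNeighbourhood : ∀ {x} → (∀ {u} → Distant u → distantDegree x ≤ distantDegree u) →
    MinimalNeighbourhood x
  minimalNeighbourhood {x} minimal {p} {q} pD qD xp q≁p x≁q
    with any? (λ z → Distant? z ×-dec Adj? z q ×-dec ¬? (Adj? z x))
  ... | yes found = found
  ... | no none = ⊥-elim (n≮n _ (≤-trans
    (count-< neighbours⊆ p (dec-false (DistantNeighbour? q p) (q≁p ∘ proj₂))
                           (dec-true (DistantNeighbour? x p) (pD , xp)))
    (minimal qD)))
    where
    neighbours⊆ : (does ∘ DistantNeighbour? q) ⊆ᵇ (does ∘ DistantNeighbour? x)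
    neighbours⊆ z qz? with zD , qz ← does⇒ (DistantNeighbour? q z) qz? = dec-true (DistantNeighbour? x z)
      (zD , decidable-stable (Adj? x z) (λ x≁z → none (z , zD , Adj-sym qz , ¬Adj-sym x≁z)))

  choose : ∃[ x ] x ≢ v × x ≢ w × Choice x
  choose with any? Distant?
  ... | yes (x₀ , x₀D) = x , ≢v xD , ≢w xD , inj₁ (xD , minimalNeighbourhood minimal)
    where
    distants = filter Distant? (allFin (4 + m))
    x = argmin distantDegree x₀ distants
    xD : Distant x
    xD = argmin-all distantDegree x₀D (all-filter Distant? (allFin (4 + m)))
    minimal : ∀ {u} → Distant u → distantDegree x ≤ distantDegree u
    minimal uD = All.lookup (f[argmin]≤f[xs] x₀ distants) (∈-filter⁺ Distant? (∈-allFin _) uD)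
  ... | no none = skip₂ (≢-sym v≢w) zero , skip₂≢q (≢-sym v≢w) zero , skip₂≢p (≢-sym v≢w) zero ,
    inj₂ (λ u u≢v u≢w → decidable-stable (Adj? w u) (λ w≁u → none (u , distant u≢v u≢w w≁u)))

  noCoreConfiguration : ∀ {x p k q z} → Distant x → Distant p → Distant q → Distant z →
    Adj G w k → Adj G x p → Adj G p k → ¬ Adj G x k → ¬ Adj G x q → ¬ Adj G p q → ¬ Adj G k q →
    x ≢ q → p ≢ q → Adj G z q → ¬ Adj G z x → ⊥
  noCoreConfiguration {x} {p} {k} {q} {z} xD pD qD zD wk xp pk x≁k x≁q p≁q k≁q x≢q p≢q zq z≁x =
    ¬colourable (mergeThreePairs
      ((≢-sym (≢w zD) ∷ ≢-sym (≢w xD) ∷ Adj⇒≢ wk ∷ ≢-sym (≢w pD) ∷ ≢-sym (≢w qD) ∷ []) ∷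
       (Adj-¬Adj⇒≢ zq x≁q ∷ ≢-sym (k≢ zD) ∷ Adj-¬Adj⇒≢ zq p≁q ∷ Adj⇒≢ zq ∷ []) ∷
       (≢-sym (k≢ xD) ∷ Adj⇒≢ xp ∷ x≢q ∷ []) ∷ (≢-sym (Adj⇒≢ pk) ∷ k≢ qD ∷ []) ∷ (p≢q ∷ []) ∷ [] ∷ [])
      (w≁ zD) x≁k p≁q
      (noBicolouredP₄-pair (inj₁ (w≁ xD) ∷ inj₁ z≁x ∷ []))
      (noBicolouredP₄-sym (noBicolouredP₄-pair (inj₁ (≁w pD) ∷ inj₁ (≁w qD) ∷ [])))
      (noBicolouredP₄-pair (inj₂ x≁q ∷ inj₂ k≁q ∷ [])))
    where
    k≢ : ∀ {u} → Distant u → k ≢ u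
    k≢ uD = Adj-¬Adj⇒≢ (Adj-sym wk) (≁w uD)

  module Recolouring (x : V) {k : ℕ} {f : V → Fin k} (f-star : IsStarColoring (deleteEdge G v x) k f) where

    H : Graph (4 + m)
    H = deleteEdge G v x

    Adj-Hˡ : ∀ {a b} → Adj G a b → a ≢ v → a ≢ x → Adj H a b
    Adj-Hˡ ab a≢v a≢x = Adj-deleteEdge G v x ab (a≢v ∘ proj₁) (a≢x ∘ proj₁)

    Adj-Hʳ : ∀ {a b} → Adj G a b → b ≢ v → b ≢ x → Adj H a b
    Adj-Hʳ ab b≢v b≢x = Adj-deleteEdge G v x ab (b≢x ∘ proj₂) (b≢v ∘ proj₂)

    edge-H : ∀ {a b} → Adj G a b → Adj H a b ⊎ (a ≡ v × b ≡ x) ⊎ (a ≡ x × b ≡ v)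
    edge-H {a} {b} ab with (a ≟ v ×-dec b ≟ x) ⊎-dec (a ≟ x ×-dec b ≟ v)
    ... | yes vx = inj₂ vx
    ... | no ¬vx = inj₁ (Adj-deleteEdge G v x ab (¬vx ∘ inj₁) (¬vx ∘ inj₂))

    f-proper : ∀ {a b} → Adj H a b → f a ≢ f b
    f-proper = proj₁ f-star _ _

    f-noBicoloured : ∀ {a b c d} → a ≢ c → b ≢ d → a ≢ d →
      Adj H a b → Adj H b c → Adj H c d → f a ≡ f c → f b ≡ f d → ⊥
    f-noBicoloured a≢c b≢d a≢d ab bc cd ac bd = proj₂ f-star _ _ _ _ a≢c b≢d a≢d ab bc cd (ac , bd)

    twinOfV : ∀ {u} → f u ≡ f v → u ≢ v → u ≢ x → u ≡ w
    twinOfV {u} fu≡fv u≢v u≢x =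
      decidable-stable (u ≟ w) (λ u≢w → f-proper (Adj-Hʳ (v-dominates u u≢v u≢w) u≢v u≢x) (sym fu≡fv))

    -- When f v ≢ f x, the only way in which adding vx back can create a bicoloured P₄.
    Obstruction : Set
    Obstruction = f v ≡ f w × ∃[ a ] a ≢ x × f a ≡ f x × (Adj G w a ⊎ Adj G w x)

    obstruction : ∀ {c a} → f c ≡ f v → c ≢ v → c ≢ x → Adj G c a ⊎ Adj G c x → a ≢ x → f a ≡ f x →
      Obstruction
    obstruction fc≡fv c≢v c≢x adj a≢x fa≡fx with refl ← twinOfV fc≡fv c≢v c≢x =
      sym fc≡fv , _ , a≢x , fa≡fx , adj

    isStarColoring-G : f v ≢ f x → ¬ Obstruction → IsStarColoring G k f
    isStarColoring-G fv≢fx unobstructed = proper , starry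
      where
      proper : ∀ a b → Adj G a b → f a ≢ f b
      proper a b ab with edge-H ab
      ... | inj₁ ab′                   = f-proper ab′
      ... | inj₂ (inj₁ (refl , refl)) = fv≢fx
      ... | inj₂ (inj₂ (refl , refl)) = fv≢fx ∘ sym
      starry : ∀ a b c d → a ≢ c → b ≢ d → a ≢ d → Adj G a b → Adj G b c → Adj G c d →
        ¬ (f a ≡ f c × f b ≡ f d)
      starry a b c d a≢c b≢d a≢d ab bc cd (ac , bd) with edge-H ab | edge-H bc | edge-H cd
      ... | inj₂ (inj₁ (refl , refl)) | _ | _ = unobstructed
        (obstruction (sym ac) (≢-sym a≢c) (≢-sym (Adj⇒≢ bc)) (inj₁ cd) (≢-sym b≢d) (sym bd))
      ... | inj₂ (inj₂ (refl , refl)) | _ | _ = unobstructed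
        (obstruction (sym bd) (≢-sym b≢d) (≢-sym a≢d) (inj₁ (Adj-sym cd)) (≢-sym a≢c) (sym ac))
      ... | inj₁ _ | inj₂ (inj₁ (refl , refl)) | _ = unobstructed
        (obstruction (sym bd) (≢-sym b≢d) (≢-sym (Adj⇒≢ cd)) (inj₂ (Adj-sym cd)) a≢c ac)
      ... | inj₁ _ | inj₂ (inj₂ (refl , refl)) | _ = unobstructed
        (obstruction ac a≢c (Adj⇒≢ ab) (inj₂ ab) (≢-sym b≢d) (sym bd))
      ... | inj₁ _ | inj₁ _ | inj₂ (inj₁ (refl , refl)) = unobstructed
        (obstruction ac a≢c a≢d (inj₁ ab) b≢d bd)
      ... | inj₁ _ | inj₁ _ | inj₂ (inj₂ (refl , refl)) = unobstructed
        (obstruction bd b≢d (Adj⇒≢ bc) (inj₁ (Adj-sym ab)) a≢c ac)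
      ... | inj₁ ab′ | inj₁ bc′ | inj₁ cd′ = f-noBicoloured a≢c b≢d a≢d ab′ bc′ cd′ ac bd

  module Cases {x : V} (x≢v : x ≢ v) (x≢w : x ≢ w)
    {k : ℕ} {f : V → Fin k} (f-star : IsStarColoring (deleteEdge G v x) k f) (k<2+m : k < 2 + m) where
    open Recolouring x f-star

    record Free (u : V) : Set where
      constructor free
      field
        ≢v : u ≢ v
        ≢w : u ≢ w
        ≢x : u ≢ x
    open Free

    record MonoPair (a b : V) : Set where
      constructor pair
      field
        free₁ : Free a
        free₂ : Free b
        distinct   : a ≢ b
        sameColour : f a ≡ f b
    open MonoPair

    monoPair-sym : ∀ {a b} → MonoPair a b → MonoPair b a
    monoPair-sym ab = pair (free₂ ab) (free₁ ab) (≢-sym (distinct ab)) (sym (sameColour ab))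

    w≢x : w ≢ x
    w≢x = ≢-sym x≢w

    sameColour⇒¬Adj : ∀ {a b} → a ≢ v → a ≢ x → f a ≡ f b → ¬ Adj G a b
    sameColour⇒¬Adj a≢v a≢x fa≡fb ab = f-proper (Adj-Hˡ ab a≢v a≢x) fa≡fb

    monoPair-¬Adj : ∀ {a b} → MonoPair a b → ¬ Adj G a b
    monoPair-¬Adj ab = sameColour⇒¬Adj (≢v (free₁ ab)) (≢x (free₁ ab)) (sameColour ab)

    noBicolouredPathThroughV : ∀ {y a b} → y ≢ v → y ≢ b → f y ≡ f v → MonoPair a b → ¬ Adj H y a
    noBicolouredPathThroughV y≢v y≢b fy≡fv ab ya = f-noBicoloured y≢v (distinct ab) y≢b ya
      (Adj-Hˡ (Adj-sym (v-dominates _ (≢v a′) (≢w a′))) (≢v a′) (≢x a′))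
      (Adj-Hʳ (v-dominates _ (≢v b′) (≢w b′)) (≢v b′) (≢x b′)) fy≡fv (sameColour ab)
      where
      a′ = free₁ ab
      b′ = free₂ ab

    x≁monoPair : ∀ {a b} → f v ≡ f x → MonoPair a b → ¬ Adj G x a
    x≁monoPair fv≡fx ab xa = noBicolouredPathThroughV x≢v (≢-sym (≢x (free₂ ab))) (sym fv≡fx) ab
      (Adj-Hʳ xa (≢v (free₁ ab)) (≢x (free₁ ab)))

    w≁monoPair : ∀ {a b} → f w ≡ f v → MonoPair a b → ¬ Adj G w a
    w≁monoPair fw≡fv ab wa = noBicolouredPathThroughV (≢-sym v≢w) (≢-sym (≢w (free₂ ab))) fw≡fv ab
      (Adj-Hˡ wa (≢-sym v≢w) w≢x)

    noIndependentWX : ∀ {a b} → Distant x → MonoPair a b →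
      ¬ Adj G w a → ¬ Adj G w b → ¬ Adj G x a → ¬ Adj G x b → ⊥
    noIndependentWX xD ab w≁a w≁b x≁a x≁b = noIndependentQuadruple
      ((w≢x ∷ ≢-sym (≢w a′) ∷ ≢-sym (≢w b′) ∷ []) ∷ (≢-sym (≢x a′) ∷ ≢-sym (≢x b′) ∷ []) ∷
       (distinct ab ∷ []) ∷ [] ∷ [])
      ((w≁ xD ∷ w≁a ∷ w≁b ∷ []) ∷ (x≁a ∷ x≁b ∷ []) ∷ (monoPair-¬Adj ab ∷ []) ∷ [] ∷ [])
      where
      a′ = free₁ ab
      b′ = free₂ ab

    free-∈ : ∀ {a b u} → MonoPair a b → u ∈ a ∷ b ∷ [] → Free u
    free-∈ ab (here refl)         = free₁ ab
    free-∈ ab (there (here refl)) = free₂ ab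

    colour-∈ : ∀ {a b u} → MonoPair a b → u ∈ a ∷ b ∷ [] → f u ≡ f a
    colour-∈ ab (here refl)         = refl
    colour-∈ ab (there (here refl)) = sym (sameColour ab)

    monoPairs-noBicoloured : ∀ {p₁ p₂ q₁ q₂} → MonoPair p₁ p₂ → MonoPair q₁ q₂ → f p₁ ≢ f q₁ →
      NoBicolouredP₄ (Together (p₁ ∷ p₂ ∷ [])) (Together (q₁ ∷ q₂ ∷ []))
    monoPairs-noBicoloured P Q fp≢fq (a∈ , c∈) a≢c (b∈ , d∈) b≢d ab bc cd =
      f-noBicoloured a≢c b≢d (λ { refl → fp≢fq (trans (sym (colour-∈ P a∈)) (colour-∈ Q d∈)) })
        (H-edge (free-∈ P a∈) ab) (H-edge (free-∈ Q b∈) bc) (H-edge (free-∈ P c∈) cd)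
        (trans (colour-∈ P a∈) (sym (colour-∈ P c∈))) (trans (colour-∈ Q b∈) (sym (colour-∈ Q d∈)))
      where
      H-edge : ∀ {s t} → Free s → Adj G s t → Adj H s t
      H-edge s′ st = Adj-Hˡ st (≢v s′) (≢x s′)

    monoPairWithW : Choice x → f v ≡ f x → ∀ {s t} → MonoPair s t → f w ≡ f s → ⊥
    monoPairWithW (inj₂ w-dominates) _ st fw≡fs =
      sameColour⇒¬Adj (≢-sym v≢w) w≢x fw≡fs (w-dominates _ (≢v (free₁ st)) (≢w (free₁ st)))
    monoPairWithW (inj₁ (xD , _)) fv≡fx st fw≡fs = noIndependentWX xD st
      (sameColour⇒¬Adj (≢-sym v≢w) w≢x fw≡fs)
      (sameColour⇒¬Adj (≢-sym v≢w) w≢x (trans fw≡fs (sameColour st)))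
      (x≁monoPair fv≡fx st) (x≁monoPair fv≡fx (monoPair-sym st))

    monoTriple : Choice x → f v ≡ f x → ∀ {s₁ s₂ s₃} → Unique (s₁ ∷ s₂ ∷ s₃ ∷ []) →
      s₁ ≢ v → s₁ ≢ x → s₂ ≢ v → s₂ ≢ x → s₃ ≢ v → s₃ ≢ x → f s₁ ≡ f s₂ → f s₁ ≡ f s₃ → ⊥
    monoTriple choice fv≡fx {s₁} {s₂} {s₃} ((s₁≢s₂ ∷ s₁≢s₃ ∷ []) ∷ (s₂≢s₃ ∷ []) ∷ [] ∷ [])
      s₁≢v s₁≢x s₂≢v s₂≢x s₃≢v s₃≢x f₁≡f₂ f₁≡f₃ with s₁ ≟ w | s₂ ≟ w | s₃ ≟ w
    ... | yes refl | _ | _ = monoPairWithW choice fv≡fx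
      (pair (free s₂≢v (≢-sym s₁≢s₂) s₂≢x) (free s₃≢v (≢-sym s₁≢s₃) s₃≢x) s₂≢s₃ (trans (sym f₁≡f₂) f₁≡f₃)) f₁≡f₂
    ... | no s₁≢w | yes refl | _ = monoPairWithW choice fv≡fx
      (pair (free s₁≢v s₁≢w s₁≢x) (free s₃≢v (≢-sym s₂≢s₃) s₃≢x) s₁≢s₃ f₁≡f₃) (sym f₁≡f₂)
    ... | no s₁≢w | no s₂≢w | yes refl = monoPairWithW choice fv≡fx
      (pair (free s₁≢v s₁≢w s₁≢x) (free s₂≢v s₂≢w s₂≢x) s₁≢s₂ f₁≡f₂) (sym f₁≡f₃)
    ... | no s₁≢w | no s₂≢w | no s₃≢w = noIndependentQuadruple
      ((≢-sym s₁≢x ∷ ≢-sym s₂≢x ∷ ≢-sym s₃≢x ∷ []) ∷ (s₁≢s₂ ∷ s₁≢s₃ ∷ []) ∷ (s₂≢s₃ ∷ []) ∷ [] ∷ [])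
      ((x≁monoPair fv≡fx s₁s₂ ∷ x≁monoPair fv≡fx (monoPair-sym s₁s₂) ∷
        x≁monoPair fv≡fx (monoPair-sym s₁s₃) ∷ []) ∷
       (monoPair-¬Adj s₁s₂ ∷ monoPair-¬Adj s₁s₃ ∷ []) ∷ (monoPair-¬Adj s₂s₃ ∷ []) ∷ [] ∷ [])
      where
      s₁′ = free s₁≢v s₁≢w s₁≢x
      s₂′ = free s₂≢v s₂≢w s₂≢x
      s₃′ = free s₃≢v s₃≢w s₃≢x
      s₁s₂ = pair s₁′ s₂′ s₁≢s₂ f₁≡f₂
      s₁s₃ = pair s₁′ s₃′ s₁≢s₃ f₁≡f₃
      s₂s₃ = pair s₂′ s₃′ s₂≢s₃ (trans (sym f₁≡f₂) f₁≡f₃)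

    twoFreeMonoPairs : f v ≡ f x → ∀ {p₁ p₂ q₁ q₂} → MonoPair p₁ p₂ → MonoPair q₁ q₂ → f p₁ ≢ f q₁ → ⊥
    twoFreeMonoPairs fv≡fx {p₁} {p₂} {q₁} {q₂} P Q fp≢fq = ¬colourable (mergeTripleAndPair
      ((x≢ p₁′ ∷ x≢ p₂′ ∷ x≢ q₁′ ∷ x≢ q₂′ ∷ []) ∷
       (distinct P ∷ p≢q refl refl ∷ p≢q refl (sameColour Q) ∷ []) ∷
       (p≢q (sameColour P) refl ∷ p≢q (sameColour P) (sameColour Q) ∷ []) ∷ (distinct Q ∷ []) ∷ [] ∷ [])
      ((x≁monoPair fv≡fx P ∷ x≁monoPair fv≡fx (monoPair-sym P) ∷ []) ∷ (monoPair-¬Adj P ∷ []) ∷ [] ∷ [])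
      (monoPair-¬Adj Q)
      (noBicolouredP₄-cons (x≁monoPair fv≡fx Q ∷ x≁monoPair fv≡fx (monoPair-sym Q) ∷ [])
        (monoPairs-noBicoloured P Q fp≢fq)))
      where
      p₁′ = free₁ P
      p₂′ = free₂ P
      q₁′ = free₁ Q
      q₂′ = free₂ Q
      x≢ : ∀ {u} → Free u → x ≢ u
      x≢ u′ = ≢-sym (≢x u′)
      p≢q : ∀ {p q} → f p₁ ≡ f p → f q₁ ≡ f q → p ≢ q
      p≢q fp₁≡fp fq₁≡fq refl = fp≢fq (trans fp₁≡fp (sym fq₁≡fq))

    wPairAndMonoPair-oneNeighbour : Distant x → MinimalNeighbourhood x → f v ≡ f x → ∀ {p q₁ q₂} →
      Free p → f w ≡ f p → MonoPair q₁ q₂ → f p ≢ f q₁ → Adj G w q₁ → ¬ Adj G w q₂ → ⊥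
    wPairAndMonoPair-oneNeighbour xD minimal fv≡fx {p} {q₁} {q₂} p′ fw≡fp Q fp≢fq wq₁ w≁q₂ =
      byAdjacency (Adj? p q₁)
      where
      q₁′ = free₁ Q
      q₂′ = free₂ Q
      p≢q₁ : p ≢ q₁
      p≢q₁ = fp≢fq ∘ cong f
      p≢q₂ : p ≢ q₂
      p≢q₂ p≡q₂ = fp≢fq (trans (cong f p≡q₂) (sym (sameColour Q)))
      w≁p = sameColour⇒¬Adj (≢-sym v≢w) w≢x fw≡fp
      x≁q₁ = x≁monoPair fv≡fx Q
      x≁q₂ = x≁monoPair fv≡fx (monoPair-sym Q)
      byAdjacency : Dec (Adj G p q₁) → ⊥
      byAdjacency (no p≁q₁) = ¬colourable (mergeTripleAndPair
        ((w≢x ∷ ≢-sym (≢w q₂′) ∷ ≢-sym (≢w q₁′) ∷ ≢-sym (≢w p′) ∷ []) ∷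
         (≢-sym (≢x q₂′) ∷ ≢-sym (≢x q₁′) ∷ ≢-sym (≢x p′) ∷ []) ∷
         (≢-sym (distinct Q) ∷ ≢-sym p≢q₂ ∷ []) ∷ (≢-sym p≢q₁ ∷ []) ∷ [] ∷ [])
        ((w≁ xD ∷ w≁q₂ ∷ []) ∷ (x≁q₂ ∷ []) ∷ [] ∷ [])
        (¬Adj-sym p≁q₁)
        (noBicolouredP₄-pair (inj₂ w≁p ∷ inj₁ x≁q₁ ∷ inj₁ (monoPair-¬Adj (monoPair-sym Q)) ∷ [])))
      byAdjacency (yes pq₁) = byAdjacencyToX (Adj? p x)
        where
        p≁q₂ : ¬ Adj G p q₂
        p≁q₂ pq₂ = f-noBicoloured (≢-sym (distinct Q)) (≢w p′) (≢w q₂′)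
          (Adj-Hˡ (Adj-sym pq₂) (≢v q₂′) (≢x q₂′)) (Adj-Hˡ pq₁ (≢v p′) (≢x p′))
          (Adj-Hˡ (Adj-sym wq₁) (≢v q₁′) (≢x q₁′)) (sym (sameColour Q)) (sym fw≡fp)
        pD = distant (≢v p′) (≢w p′) w≁p
        q₂D = distant (≢v q₂′) (≢w q₂′) w≁q₂
        byAdjacencyToX : Dec (Adj G p x) → ⊥
        byAdjacencyToX (no p≁x) = noIndependentQuadruple
          ((≢-sym (≢w p′) ∷ w≢x ∷ ≢-sym (≢w q₂′) ∷ []) ∷ (≢x p′ ∷ p≢q₂ ∷ []) ∷ (≢-sym (≢x q₂′) ∷ []) ∷ [] ∷ [])
          ((w≁p ∷ w≁ xD ∷ w≁q₂ ∷ []) ∷ (p≁x ∷ p≁q₂ ∷ []) ∷ (x≁q₂ ∷ []) ∷ [] ∷ [])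
        byAdjacencyToX (yes px) with minimal pD q₂D (Adj-sym px) (¬Adj-sym p≁q₂) x≁q₂
        ... | z , zD , zq₂ , z≁x = noCoreConfiguration xD pD q₂D zD wq₁ (Adj-sym px) pq₁ x≁q₁ x≁q₂ p≁q₂
          (monoPair-¬Adj Q) (≢-sym (≢x q₂′)) p≢q₂ zq₂ z≁x

    wPairAndMonoPair : Choice x → f v ≡ f x → ∀ {p q₁ q₂} → Free p → f w ≡ f p →
      MonoPair q₁ q₂ → f p ≢ f q₁ → ⊥
    wPairAndMonoPair (inj₂ w-dominates) _ p′ fw≡fp _ _ =
      sameColour⇒¬Adj (≢-sym v≢w) w≢x fw≡fp (w-dominates _ (≢v p′) (≢w p′))
    wPairAndMonoPair (inj₁ (xD , minimal)) fv≡fx {p} {q₁} {q₂} p′ fw≡fp Q fp≢fq with Adj? w q₁ | Adj? w q₂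
    ... | no w≁q₁ | no w≁q₂ =
      noIndependentWX xD Q w≁q₁ w≁q₂ (x≁monoPair fv≡fx Q) (x≁monoPair fv≡fx (monoPair-sym Q))
    ... | yes wq₁ | no w≁q₂ = wPairAndMonoPair-oneNeighbour xD minimal fv≡fx p′ fw≡fp Q fp≢fq wq₁ w≁q₂
    ... | no w≁q₁ | yes wq₂ = wPairAndMonoPair-oneNeighbour xD minimal fv≡fx p′ fw≡fp (monoPair-sym Q)
      (λ fp≡fq₂ → fp≢fq (trans fp≡fq₂ (sym (sameColour Q)))) wq₂ w≁q₁
    ... | yes wq₁ | yes wq₂ = ¬colourable (mergeTripleAndPair
      ((≢-sym (≢x q₁′) ∷ ≢-sym (≢x q₂′) ∷ x≢w ∷ ≢-sym (≢x p′) ∷ []) ∷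
       (distinct Q ∷ ≢w q₁′ ∷ ≢-sym (p≢q refl) ∷ []) ∷ (≢w q₂′ ∷ ≢-sym (p≢q (sameColour Q)) ∷ []) ∷
       (≢-sym (≢w p′) ∷ []) ∷ [] ∷ [])
      ((x≁monoPair fv≡fx Q ∷ x≁monoPair fv≡fx (monoPair-sym Q) ∷ []) ∷ (monoPair-¬Adj Q ∷ []) ∷ [] ∷ [])
      (sameColour⇒¬Adj (≢-sym v≢w) w≢x fw≡fp)
      (noBicolouredP₄-pair (inj₁ (≁w xD) ∷ inj₂ (q≁p (monoPair-sym Q) (p≢q (sameColour Q)) wq₂ wq₁) ∷
                            inj₂ (q≁p Q (p≢q refl) wq₁ wq₂) ∷ [])))
      where
      q₁′ = free₁ Q
      q₂′ = free₂ Q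
      p≢q : ∀ {q} → f q₁ ≡ f q → p ≢ q
      p≢q fq₁≡fq p≡q = fp≢fq (trans (cong f p≡q) (sym fq₁≡fq))
      q≁p : ∀ {q q′} → MonoPair q′ q → p ≢ q′ → Adj G w q′ → Adj G w q → ¬ Adj G q p
      q≁p Q′ p≢q′ wq′ wq qp = f-noBicoloured (distinct Q′) (≢-sym (≢w p′)) (≢-sym p≢q′)
        (Adj-Hˡ (Adj-sym wq′) (≢v (free₁ Q′)) (≢x (free₁ Q′))) (Adj-Hˡ wq (≢-sym v≢w) w≢x)
        (Adj-Hˡ qp (≢v (free₂ Q′)) (≢x (free₂ Q′))) (sameColour Q′) fw≡fp

    monoPair-or-w : ∀ {a b} → a ≢ v → a ≢ x → b ≢ v → b ≢ x → a ≢ b → f a ≡ f b →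
      MonoPair a b ⊎ ∃[ p ] Free p × f w ≡ f p × f p ≡ f a
    monoPair-or-w {a} {b} a≢v a≢x b≢v b≢x a≢b fa≡fb with a ≟ w | b ≟ w
    ... | yes refl | _        = inj₂ (b , free b≢v (≢-sym a≢b) b≢x , fa≡fb , sym fa≡fb)
    ... | no a≢w   | yes refl = inj₂ (a , free a≢v a≢b a≢x , sym fa≡fb , refl)
    ... | no a≢w   | no b≢w   = inj₁ (pair (free a≢v a≢w a≢x) (free b≢v b≢w b≢x) a≢b fa≡fb)

    twoMonoPairs : Choice x → f v ≡ f x → ∀ {p₁ p₂ q₁ q₂} →
      p₁ ≢ v → p₁ ≢ x → p₂ ≢ v → p₂ ≢ x → q₁ ≢ v → q₁ ≢ x → q₂ ≢ v → q₂ ≢ x →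
      p₁ ≢ p₂ → q₁ ≢ q₂ → f p₁ ≡ f p₂ → f q₁ ≡ f q₂ → f p₁ ≢ f q₁ → ⊥
    twoMonoPairs choice fv≡fx {p₁} {p₂} {q₁} {q₂} p₁≢v p₁≢x p₂≢v p₂≢x q₁≢v q₁≢x q₂≢v q₂≢x p₁≢p₂ q₁≢q₂ fp fq fp≢fq
      with monoPair-or-w p₁≢v p₁≢x p₂≢v p₂≢x p₁≢p₂ fp | monoPair-or-w q₁≢v q₁≢x q₂≢v q₂≢x q₁≢q₂ fq
    ... | inj₁ P | inj₁ Q = twoFreeMonoPairs fv≡fx P Q fp≢fq
    ... | inj₂ (p , p′ , fw≡fp , fp≡fp₁) | inj₁ Q =
      wPairAndMonoPair choice fv≡fx p′ fw≡fp Q (fp≢fq ∘ trans (sym fp≡fp₁))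
    ... | _ | inj₂ (q , q′ , fw≡fq , fq≡fq₁) with monoPair-or-w p₁≢v p₁≢x p₂≢v p₂≢x p₁≢p₂ fp
    ...   | inj₁ P = wPairAndMonoPair choice fv≡fx q′ fw≡fq P (fp≢fq ∘ sym ∘ trans (sym fq≡fq₁))
    ...   | inj₂ (p , _ , fw≡fp , fp≡fp₁) =
      fp≢fq (trans (sym fp≡fp₁) (trans (sym fw≡fp) (trans fw≡fq fq≡fq₁)))

    partnerOfV : ∀ {a b} → a ≢ b → b ≢ x → f a ≡ f b → a ≡ v → b ≡ w
    partnerOfV a≢b b≢x fa≡fb refl = twinOfV (sym fa≡fb) (≢-sym a≢b) b≢x

    vxwShareColour : Choice x → f v ≡ f x → f w ≡ f v → ⊥
    vxwShareColour (inj₂ w-dominates) fv≡fx fw≡fv =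
      f-proper (Adj-Hˡ (w-dominates x x≢v x≢w) (≢-sym v≢w) w≢x) (trans fw≡fv fv≡fx)
    vxwShareColour (inj₁ (xD , _)) fv≡fx fw≡fv with collisionAvoiding k<2+m f w≢x
    ... | collision a≢b a≢w a≢x b≢w b≢x fa≡fb = noIndependentWX xD ab
      (w≁monoPair fw≡fv ab) (w≁monoPair fw≡fv (monoPair-sym ab))
      (x≁monoPair fv≡fx ab) (x≁monoPair fv≡fx (monoPair-sym ab))
      where
      ab = pair (free (b≢w ∘ partnerOfV a≢b b≢x fa≡fb) a≢w a≢x)
                (free (a≢w ∘ partnerOfV (≢-sym a≢b) a≢x (sym fa≡fb)) b≢w b≢x) a≢b fa≡fb

    ≢v-ofCollision : f w ≢ f v → ∀ {a b} → a ≢ b → b ≢ x → f a ≡ f b → a ≢ v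
    ≢v-ofCollision fw≢fv a≢b b≢x fa≡fb refl with refl ← twinOfV (sym fa≡fb) (≢-sym a≢b) b≢x = fw≢fv (sym fa≡fb)

    vxShareColour : Choice x → f v ≡ f x → f w ≢ f v → ⊥
    vxShareColour choice fv≡fx fw≢fv with collisionAvoiding k<2+m f x≢v
    ... | collision {a} {b} a≢b a≢x a≢v b≢x b≢v fa≡fb with collisionAvoiding k<2+m f (≢-sym b≢x)
    ... | collision {a₂} {b₂} a₂≢b₂ a₂≢x a₂≢b b₂≢x b₂≢b fa₂≡fb₂ =
      secondPair (f a₂ ≟ f a) (b₂ ≟ a)
        (≢v-ofCollision fw≢fv a₂≢b₂ b₂≢x fa₂≡fb₂) (≢v-ofCollision fw≢fv (≢-sym a₂≢b₂) a₂≢x (sym fa₂≡fb₂))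
      where
      secondPair : Dec (f a₂ ≡ f a) → Dec (b₂ ≡ a) → a₂ ≢ v → b₂ ≢ v → ⊥
      secondPair (no differ) _ a₂≢v b₂≢v =
        twoMonoPairs choice fv≡fx a≢v a≢x b≢v b≢x a₂≢v a₂≢x b₂≢v b₂≢x a≢b a₂≢b₂ fa≡fb fa₂≡fb₂ (differ ∘ sym)
      secondPair (yes same) (no b₂≢a) _ b₂≢v =
        monoTriple choice fv≡fx ((a≢b ∷ ≢-sym b₂≢a ∷ []) ∷ (≢-sym b₂≢b ∷ []) ∷ [] ∷ [])
          a≢v a≢x b≢v b≢x b₂≢v b₂≢x fa≡fb (trans (sym same) fa₂≡fb₂)
      secondPair (yes same) (yes b₂≡a) a₂≢v _ =
        monoTriple choice fv≡fx
          ((a≢b ∷ (λ a≡a₂ → a₂≢b₂ (trans (sym a≡a₂) (sym b₂≡a))) ∷ []) ∷ (≢-sym a₂≢b ∷ []) ∷ [] ∷ [])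
          a≢v a≢x b≢v b≢x a₂≢v a₂≢x fa≡fb (sym same)

    monoPairLinkedToX : Distant x → MinimalNeighbourhood x → ∀ {y m₁ m₂} → Adj G w y → y ≢ x → f y ≡ f x →
      MonoPair m₁ m₂ → Distant m₁ → Distant m₂ → Adj G x m₁ → ⊥
    monoPairLinkedToX xD minimal {y} {m₁} {m₂} wy y≢x fy≡fx M m₁D m₂D xm₁ =
      byAdjacencies (Adj? x m₂) (Adj? y m₁)
      where
      m₁′ = free₁ M
      m₂′ = free₂ M
      y≢v = neighbourOfW≢v wy
      y≢w : y ≢ w
      y≢w = ≢-sym (Adj⇒≢ wy)
      x≁y : ¬ Adj G x y
      x≁y = ¬Adj-sym (sameColour⇒¬Adj y≢v y≢x fy≡fx)
      y≢ : ∀ {u} → Distant u → y ≢ u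
      y≢ uD = Adj-¬Adj⇒≢ (Adj-sym wy) (≁w uD)
      byAdjacencies : Dec (Adj G x m₂) → Dec (Adj G y m₁) → ⊥
      byAdjacencies (yes xm₂) _ = ¬colourable (mergeTripleAndPair
        ((y≢ m₁D ∷ y≢ m₂D ∷ y≢w ∷ y≢x ∷ []) ∷ (distinct M ∷ ≢w m₁′ ∷ ≢x m₁′ ∷ []) ∷
         (≢w m₂′ ∷ ≢x m₂′ ∷ []) ∷ (w≢x ∷ []) ∷ [] ∷ [])
        ((y≁ M m₂D xm₁ xm₂ ∷ y≁ (monoPair-sym M) m₁D xm₂ xm₁ ∷ []) ∷ (monoPair-¬Adj M ∷ []) ∷ [] ∷ [])
        (w≁ xD)
        (noBicolouredP₄-pair (inj₂ (¬Adj-sym x≁y) ∷ inj₁ (≁w m₁D) ∷ inj₁ (≁w m₂D) ∷ [])))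
        where
        y≁ : ∀ {m m′} → MonoPair m m′ → Distant m′ → Adj G x m → Adj G x m′ → ¬ Adj G y m
        y≁ M′ m′D xm xm′ ym = f-noBicoloured y≢x (distinct M′) (y≢ m′D)
          (Adj-Hˡ ym y≢v y≢x) (Adj-Hˡ (Adj-sym xm) (≢v (free₁ M′)) (≢x (free₁ M′)))
          (Adj-Hʳ xm′ (≢v (free₂ M′)) (≢x (free₂ M′))) fy≡fx (sameColour M′)
      byAdjacencies (no x≁m₂) (no y≁m₁) = ¬colourable (mergeTripleAndPair
        ((w≢x ∷ ≢-sym (≢w m₂′) ∷ ≢-sym y≢w ∷ ≢-sym (≢w m₁′) ∷ []) ∷
         (≢-sym (≢x m₂′) ∷ ≢-sym y≢x ∷ ≢-sym (≢x m₁′) ∷ []) ∷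
         (≢-sym (y≢ m₂D) ∷ ≢-sym (distinct M) ∷ []) ∷ (y≢ m₁D ∷ []) ∷ [] ∷ [])
        ((w≁ xD ∷ w≁ m₂D ∷ []) ∷ (x≁m₂ ∷ []) ∷ [] ∷ [])
        y≁m₁
        (noBicolouredP₄-pair (inj₂ (w≁ m₁D) ∷ inj₁ x≁y ∷ inj₂ (monoPair-¬Adj (monoPair-sym M)) ∷ [])))
      byAdjacencies (no x≁m₂) (yes ym₁) with minimal m₁D m₂D xm₁ (monoPair-¬Adj (monoPair-sym M)) x≁m₂
      ... | z , zD , zm₂ , z≁x = noCoreConfiguration xD m₁D m₂D zD wy xm₁ (Adj-sym ym₁) x≁y x≁m₂
        (monoPair-¬Adj M) y≁m₂ (≢-sym (≢x m₂′)) (distinct M) zm₂ z≁x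
        where
        y≁m₂ : ¬ Adj G y m₂
        y≁m₂ ym₂ = f-noBicoloured (≢-sym (distinct M)) y≢x (≢x m₂′)
          (Adj-Hˡ (Adj-sym ym₂) (≢v m₂′) (≢x m₂′)) (Adj-Hˡ ym₁ y≢v y≢x) (Adj-Hˡ (Adj-sym xm₁) (≢v m₁′) (≢x m₁′))
          (sym (sameColour M)) fy≡fx

    wNeighbourColouredLikeX : Distant x → MinimalNeighbourhood x → f v ≢ f x → f v ≡ f w →
      ∀ {y} → Adj G w y → y ≢ x → f y ≡ f x → ⊥
    wNeighbourColouredLikeX xD minimal fv≢fx fv≡fw {y} wy y≢x fy≡fx with collisionAvoiding k<2+m f (Adj⇒≢ wy)
    ... | collision {a} {b} a≢b a≢w a≢y b≢w b≢y fa≡fb = byAdjacency (Adj? x a) (Adj? x b)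
      where
      y≢v = neighbourOfW≢v wy
      y≢w : y ≢ w
      y≢w = ≢-sym (Adj⇒≢ wy)
      ≢v′ : ∀ {a b} → a ≢ b → b ≢ w → f a ≡ f b → a ≢ v
      ≢v′ a≢b b≢w fa≡fb refl =
        b≢w (twinOfV (sym fa≡fb) (≢-sym a≢b) (λ b≡x → fv≢fx (trans fa≡fb (cong f b≡x))))
      ≢x′ : ∀ {a b} → a ≢ b → b ≢ w → b ≢ y → f a ≡ f b → b ≢ v → a ≢ x
      ≢x′ a≢b b≢w b≢y fa≡fb b≢v refl = f-noBicoloured (≢-sym v≢w) (≢-sym b≢y) (≢-sym b≢w)
        (Adj-Hˡ wy (≢-sym v≢w) w≢x) (Adj-Hˡ (Adj-sym (v-dominates _ y≢v y≢w)) y≢v y≢x)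
        (Adj-Hʳ (v-dominates _ b≢v b≢w) b≢v (≢-sym a≢b)) (sym fv≡fw) (trans fy≡fx fa≡fb)
      a≢v = ≢v′ a≢b b≢w fa≡fb
      b≢v = ≢v′ (≢-sym a≢b) a≢w (sym fa≡fb)
      ab : MonoPair a b
      ab = pair (free a≢v a≢w (≢x′ a≢b b≢w b≢y fa≡fb b≢v))
                (free b≢v b≢w (≢x′ (≢-sym a≢b) a≢w a≢y (sym fa≡fb) a≢v)) a≢b fa≡fb
      ba = monoPair-sym ab
      w≁ᵐ : ∀ {m₁ m₂} → MonoPair m₁ m₂ → ¬ Adj G w m₁
      w≁ᵐ = w≁monoPair (sym fv≡fw)
      distantᵐ : ∀ {m₁ m₂} → MonoPair m₁ m₂ → Distant m₁
      distantᵐ M = distant (≢v (free₁ M)) (≢w (free₁ M)) (w≁ᵐ M)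
      byAdjacency : Dec (Adj G x a) → Dec (Adj G x b) → ⊥
      byAdjacency (no x≁a) (no x≁b) = noIndependentWX xD ab (w≁ᵐ ab) (w≁ᵐ ba) x≁a x≁b
      byAdjacency (yes xa) _        = monoPairLinkedToX xD minimal wy y≢x fy≡fx ab (distantᵐ ab) (distantᵐ ba) xa
      byAdjacency (no _)   (yes xb) = monoPairLinkedToX xD minimal wy y≢x fy≡fx ba (distantᵐ ba) (distantᵐ ab) xb

    unobstructed : Choice x → f v ≢ f x → ¬ Obstruction
    unobstructed (inj₁ (xD , _)) _ (_ , _ , _ , _ , inj₂ wx) = w≁ xD wx
    unobstructed (inj₁ (xD , minimal)) fv≢fx (fv≡fw , _ , a≢x , fa≡fx , inj₁ wa) =
      wNeighbourColouredLikeX xD minimal fv≢fx fv≡fw wa a≢x fa≡fx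
    unobstructed (inj₂ w-dominates) fv≢fx (fv≡fw , a , a≢x , fa≡fx , _) =
      f-noBicoloured (≢-sym a≢x) (≢-sym v≢w) x≢v
        (Adj-Hʳ (Adj-sym (w-dominates x x≢v x≢w)) (≢-sym v≢w) w≢x)
        (Adj-Hˡ (w-dominates a a≢v a≢w) (≢-sym v≢w) w≢x)
        (Adj-Hˡ (Adj-sym (v-dominates a a≢v a≢w)) a≢v a≢x) (sym fa≡fx) (sym fv≡fw)
      where
      a≢v : a ≢ v
      a≢v refl = fv≢fx fa≡fx
      a≢w : a ≢ w
      a≢w refl = fv≢fx (trans fv≡fw fa≡fx)

    deletionColouring-absurd : Choice x → ¬ StarColorable G k → ⊥
    deletionColouring-absurd choice ¬k-colourable with f v ≟ f x | f w ≟ f v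
    ... | yes fv≡fx | yes fw≡fv = vxwShareColour choice fv≡fx fw≡fv
    ... | yes fv≡fx | no fw≢fv  = vxShareColour choice fv≡fx fw≢fv
    ... | no fv≢fx  | _         =
      ¬k-colourable (f , isStarColoring-G fv≢fx (unobstructed choice fv≢fx))

mainTheorem18 : (n : ℕ) → 5 ≤ n → (G : Graph n) → Connected G →
    StarChromatic G (n ∸ 2) → MaxDegree G (n ∸ 2) → ¬ Critical G (n ∸ 2)
mainTheorem18 _ (s≤s (s≤s (s≤s (s≤s (s≤s {n = r} _))))) G _ (_ , ¬fewer) (_ , v , deg) (_ , critical) =
  let w , w≢v , v≁w = nonNeighbour v deg
      v-dominates = adjacent-except v w deg w≢v v≁w
      open Setting G (≢-sym w≢v) v≁w v-dominates (¬fewer (2 + r) ≤-refl)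
      x , x≢v , x≢w , choice = choose
      k , k<3+r , f , f-star = critical v x (v-dominates x x≢v x≢w)
  in Cases.deletionColouring-absurd x≢v x≢w f-star k<3+r choice (¬fewer k k<3+r)
  where open DegreeProperties G
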